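{- Let $E=\{0,1,\dots,n\}$ and let $M$ be a simple perfect matroid design of rank $r+1$ on $E$ with flat sizes $1=n_1<n_2<\dots<n_r$; set $n_0=0$, $n_{r+1}=n+1$. Let $c=(c_1,\dots,c_n)$ be nonnegative integers with $c_1+\dots+c_n=r$, and let $1\le i\le r$ with $c_{n_i}\ge2$. Then \[(n_{i+1}-n_{i-1})A_c(M)=(n_i-n_{i-1})A_{c-e_{n_i}+e_{n_{i+1}}}(M)+(n_{i+1}-n_i)A_{c-e_{n_i}+e_{n_{i-1}}}(M).\]
   Context: A simple perfect matroid design of rank $r+1$ on $E$ is a simple matroid for which there are integers $1=n_1<n_2<\dots<n_r$ such that every flat of rank $j$ has exactly $n_j$ elements. The Chow ring $A^*(M)$ (real coefficients) is $\mathbb{R}[x_F : F \text{ a nonempty proper flat of } M]$ modulo the ideal generated by all $x_{F_1}x_{F_2}$ with $F_1,F_2$ incomparable and all $\sum_{F\ni i}x_F-\sum_{F\ni j}x_F$ for $i,j\in E$; $\deg_M:A^r(M)\to\mathbb{R}$ is the linear map with value $1$ on $x_{F_1}\cdots x_{F_r}$ for each complete flag of flats. For $S\subseteq E$, $x_S$ means the generator if $S$ is a nonempty proper flat and $0$ otherwise. Hypersimplex classes: $\gamma_k=\sum_S\left(\min(|S|,k)-\frac{k}{n+1}|S|\right)x_S$ for $1\le k\le n$ (sum over nonempty proper $S\subsetneq E$), $\gamma_k=0$ for $k\le0$ or $k\ge n+1$. For a vector $c=(c_0,c_1,\dots,c_{n+1})$ of nonnegative integers (entries indexed by $0,\dots,n+1$,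 with $c_0=c_{n+1}=0$ unless stated) summing to $r$, the matroidal mixed Eulerian number is $A_c(M)=\deg_M(\gamma_0^{c_0}\gamma_1^{c_1}\cdots\gamma_n^{c_n}\gamma_{n+1}^{c_{n+1}})$, which is $0$ if $c_0>0$ or $c_{n+1}>0$. $e_k$ denotes the $k$th standard unit vector. -}

module Defs where

open import Data.Bool using (Bool; true; false; _∧_; _∨_; not; if_then_else_)
open import Data.Nat as ℕ using (ℕ; zero; suc; _≤_; _<_; _⊓_; _<ᵇ_; _≡ᵇ_)
open import Data.Integer using (+_)
open import Data.Rational using (ℚ; _/_; _+_; _-_; _*_; 0ℚ; 1ℚ)
open import Data.Bool.Properties using () renaming (_≟_ to _≟ᵇ_)
open import Data.Fin using (Fin)
open import Data.Fin.Subset using (Subset; _∪_; _∩_; _⊆_; _⊂_; ∣_∣; ⁅_⁆; ⊤; _∈_; _∉_; inside; outside)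
open import Data.Vec using (Vec; []; _∷_; lookup)
open import Data.List using (List; []; _∷_; filter; map; foldr; concat; replicate; length; upTo; allFin)
open import Data.List.Membership.Propositional renaming (_∈_ to _∈ˡ_)
open import Data.List.Relation.Binary.Permutation.Propositional using (_↭_)
open import Data.List.Relation.Unary.All using (All)
open import Data.List.Relation.Unary.Linked using (Linked)
open import Data.Product using (_×_)
open import Relation.Binary.PropositionalEquality using (_≡_; _≢_)
open import Relation.Nullary using (¬_)
open import Function using (_∘_)

record IsMatroid (m : ℕ) (rk : Subset m → ℕ) : Set where
  field
    rk-bound  : ∀ X → rk X ≤ ∣ X ∣
    rk-mono   : ∀ X Y → X ⊆ Y → rk X ≤ rk Y
    rk-submod : ∀ X Y → ℕ._+_ (rk (X ∪ Y)) (rk (X ∩ Y)) ≤ ℕ._+_ (rk X) (rk Y)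

IsSimple : (m : ℕ) → (Subset m → ℕ) → Set
IsSimple m rk = (∀ e → rk ⁅ e ⁆ ≡ 1) × (∀ e f → e ≢ f → rk (⁅ e ⁆ ∪ ⁅ f ⁆) ≡ 2)

memᵇ : ∀ {m} → Fin m → Subset m → Bool
memᵇ e F = lookup F e

isFlatᵇ : ∀ {m} → (Subset m → ℕ) → Subset m → Bool
isFlatᵇ {m} rk F =
  foldr _∧_ true (map (λ e → memᵇ e F ∨ (rk F <ᵇ rk (F ∪ ⁅ e ⁆))) (allFin m))

IsFlat : ∀ {m} → (Subset m → ℕ) → Subset m → Set
IsFlat rk F = isFlatᵇ rk F ≡ true

allSubsets : (m : ℕ) → List (Subset m)
allSubsets zero = [] ∷ []
allSubsets (suc m) =
  concat (map (λ S → (inside ∷ S) ∷ (outside ∷ S) ∷ []) (allSubsets m))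

isNPᵇ : ∀ {m} → Subset m → Bool
isNPᵇ {m} F = (0 <ᵇ ∣ F ∣) ∧ (∣ F ∣ <ᵇ m)

-- the list of nonempty proper flats (the generators of the Chow ring)
npFlats : (m : ℕ) → (Subset m → ℕ) → List (Subset m)
npFlats m rk = filter (λ F → _≟ᵇ_ (isNPᵇ F ∧ isFlatᵇ rk F) true) (allSubsets m)

IsNPFlat : ∀ {m} → (Subset m → ℕ) → Subset m → Set
IsNPFlat rk F = (isNPᵇ F ∧ isFlatᵇ rk F) ≡ true

record IsSPMD (n r : ℕ) (rk : Subset (suc n) → ℕ) (ns : ℕ → ℕ) : Set where
  field
    matroid   : IsMatroid (suc n) rk
    simple    : IsSimple (suc n) rk
    rank      : rk ⊤ ≡ suc r
    ns-one    : ns 1 ≡ 1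
    ns-incr   : ∀ j → 1 ≤ j → j < r → ns j < ns (suc j)
    ns-sizes  : ∀ j → 1 ≤ j → j ≤ r → ∀ F → IsFlat rk F → rk F ≡ j → ∣ F ∣ ≡ ns j
    ns-zero   : ns 0 ≡ 0
    ns-top    : ns (suc r) ≡ suc n

-- A linear functional on the degree-r part of R[x_F] is the same as a
-- symmetric function D on length-r lists of nonempty proper flats
-- (monomials).  deg_M is the (unique) such functional vanishing on the
-- degree-r part of the defining ideal and equal to 1 on complete flags.

sumℚ : List ℚ → ℚ
sumℚ = foldr _+_ 0ℚ

record IsDegreeMap (n r : ℕ) (rk : Subset (suc n) → ℕ)
                   (D : List (Subset (suc n)) → ℚ) : Set where
  field
    -- commutativity of the polynomial ring
    symmetric : ∀ ms ms′ → All (IsNPFlat rk) ms → length ms ≡ r →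
                ms ↭ ms′ → D ms ≡ D ms′
    -- vanishes on (monomial) * x_F x_G for F, G incomparable
    incomparable : ∀ ms F G → All (IsNPFlat rk) ms → length ms ≡ r →
                   F ∈ˡ ms → G ∈ˡ ms → ¬ (F ⊆ G) → ¬ (G ⊆ F) → D ms ≡ 0ℚ
    -- vanishes on (monomial of degree r-1) * (Σ_{F∋i} x_F - Σ_{F∋j} x_F)
    linear : ∀ ms (i j : Fin (suc n)) → All (IsNPFlat rk) ms →
             suc (length ms) ≡ r →
             sumℚ (map (λ F → D (F ∷ ms)) (filter (λ F → _≟ᵇ_ (memᵇ i F) true) (npFlats (suc n) rk)))
             ≡ sumℚ (map (λ F → D (F ∷ ms)) (filter (λ F → _≟ᵇ_ (memᵇ j F) true) (npFlats (suc n) rk)))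
    flag : ∀ ms → All (IsNPFlat rk) ms → length ms ≡ r →
           Linked _⊂_ ms → D ms ≡ 1ℚ

-- Evaluate D on a product ℓ₁ ⋯ ℓ_k of linear forms Σ_F ℓ(F) x_F
-- (sums over nonempty proper flats; x_S = 0 for other S).

evalProd : ∀ {m} → List (Subset m) → (List (Subset m) → ℚ) →
           List (Subset m → ℚ) → ℚ
evalProd L D [] = D []
evalProd L D (ℓ ∷ ls) = sumℚ (map (λ F → ℓ F * evalProd L (D ∘ (F ∷_)) ls) L)

gamma : (n k : ℕ) → Subset (suc n) → ℚ
gamma n zero S = 0ℚ
gamma n (suc k) S =
  if suc k <ᵇ suc n
  then (+ (suc k ⊓ ∣ S ∣)) / 1 - (+ (ℕ._*_ (suc k) ∣ S ∣)) / suc n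
  else 0ℚ

gammaFactors : (n : ℕ) → (ℕ → ℕ) → List (Subset (suc n) → ℚ)
gammaFactors n c = concat (map (λ k → replicate (c k) (gamma n k)) (upTo (suc (suc n))))

mixedEulerian : (n : ℕ) → (rk : Subset (suc n) → ℕ) →
                (D : List (Subset (suc n)) → ℚ) → (ℕ → ℕ) → ℚ
mixedEulerian n rk D c = evalProd (npFlats (suc n) rk) D (gammaFactors n c)

shift : (ℕ → ℕ) → ℕ → ℕ → (ℕ → ℕ)
shift c a b k = ℕ._+_ (if k ≡ᵇ b then 1 else 0) (if k ≡ᵇ a then ℕ._∸_ (c k) 1 else c k)

sumRange : (ℕ → ℕ) → ℕ → ℕ
sumRange c zero = 0
sumRange c (suc k) = ℕ._+_ (sumRange c k) (c (suc k))

ℕtoℚ : ℕ → ℚ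
ℕtoℚ a = (+ a) / 1

module Submission where

-- Write c = 2 e_B + c′ with A < B < C the consecutive flat sizes n_{i-1}, n_i, n_{i+1}, and
-- R = γ^{c′}. Then the three mixed Eulerian numbers are deg(γ_B γ_B R), deg(γ_C γ_B R) and
-- deg(γ_A γ_B R). Since γ_k = Σ_S (k ⊓ s − k s / (n+1)) x_S with s = ∣S∣, the class
-- (C − A) γ_B − (B − A) γ_C − (C − B) γ_A has coefficient
-- (C − A)(B ⊓ s) − (B − A)(C ⊓ s) − (C − B)(A ⊓ s) on x_S: the terms linear in k cancel, and
-- this is zero unless A < s < C. In a perfect matroid design only flats of size B remain.
-- For those, x_F γ_{∣F∣} = 0 in the Chow ring: the incomparability relations kill x_F x_G
-- for G not comparable with F, and for comparable G the coefficient is ∣F ∩ G∣ − ∣F∣∣G∣/(n+1),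
-- which the linear relations sum to zero by double counting.

open import Defs
open import Data.Nat using (ℕ; zero; suc; _≤_; _<_; _∸_; _⊓_; _<ᵇ_; _≡ᵇ_; z≤n; s≤s; _≤?_)
import Data.Nat as ℕ
import Data.Nat.Properties as ℕ
import Data.Nat.ListAction as ℕ
import Data.Nat.ListAction.Properties as ℕ
open import Data.Integer using (+_)
import Data.Integer as ℤ
import Data.Integer.Properties as ℤ
open import Data.Rational using (ℚ; _+_; _-_; _*_; 0ℚ; 1ℚ; _/_; toℚᵘ)
import Data.Rational as ℚ
open import Data.Rational.Properties
  using (toℚᵘ-injective; toℚᵘ-fromℚᵘ; toℚᵘ-homo-+; toℚᵘ-homo-*; +-identityˡ; +-identityʳ;
         +-inverseʳ; *-zeroˡ; *-zeroʳ; *-identityˡ; *-identityʳ; *-assoc; *-comm; *-distribˡ-+;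
         *-distribʳ-+; +-*-commutativeRing)
import Data.Rational.Unnormalised as ℚᵘ
import Data.Rational.Unnormalised.Properties as ℚᵘ
open import Data.Rational.Solver using (module +-*-Solver)
open import Algebra.Bundles using (CommutativeRing)
open import Algebra.Properties.Semiring.Sum (CommutativeRing.semiring +-*-commutativeRing)
  using (sum; sum-cong-≗; *-distribˡ-sum; *-distribʳ-sum)
open import Data.Bool using (Bool; true; false; T; if_then_else_; _∧_)
open import Data.Bool.Properties using (T-≡; T-∧; T-∨) renaming (_≟_ to _≟ᵇ_)
open import Data.Empty using (⊥-elim)
open import Data.Product using (_×_; _,_; proj₁; proj₂; ∃)
open import Data.Sum using (_⊎_; inj₁; inj₂; map₂)
open import Data.Fin using (Fin; zero; suc)
open import Data.Fin.Properties using (¬∀⟶∃¬)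
open import Data.Fin.Subset using (Subset; ∣_∣; _∩_; _∪_; _⊆_; ⁅_⁆; ⊤; ⊥; _∈_; _∉_)
open import Data.Fin.Subset.Properties
  using (_∈?_; _⊆?_; ⊆-antisym; ⊆⊤; p∩q⊆p; p∩q⊆q; x∈p∩q⁺; ∩-identityˡ; p⊆p∪q; q⊆p∪q;
         x∈p∪q⁻; x∈p∪q⁺; x∈⁅x⁆; x∈⁅y⁆⇒x≡y; p⊆q⇒∣p∣≤∣q∣; ∣⊤∣≡n; ∣⊥∣≡0; ∣p∣≤n; nonempty?;
         Empty-unique)
open import Data.Vec using ([]; _∷_)
open import Data.Vec.Properties using (lookup-zipWith; []=⇒lookup; lookup⇒[]=)
open import Data.List
  using (List; []; _∷_; [_]; map; filter; concat; replicate; length; _++_; upTo; allFin)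
open import Data.List.Properties using (length-++; length-replicate; map-++; upTo-∷ʳ)
open import Data.List.Relation.Unary.All as All using (All; []; _∷_)
open import Data.List.Relation.Unary.All.Properties using (all⁺; all⁻; all-filter)
open import Data.List.Relation.Unary.Any using (here; there)
open import Data.List.Relation.Unary.AllPairs using ([]; _∷_)
open import Data.List.Relation.Unary.Unique.Propositional using (Unique)
open import Data.List.Relation.Unary.Unique.Propositional.Properties using (upTo⁺)
open import Data.List.Membership.Propositional using () renaming (_∈_ to _∈ˡ_)
open import Data.List.Membership.Propositional.Properties using (∈-upTo⁺; ∈-allFin)
open import Data.List.Relation.Binary.Permutation.Propositional as ↭ using (_↭_)
open import Data.List.Relation.Binary.Permutation.Propositional.Properties
  using (↭-length; ++⁺ˡ) renaming (shift to ↭-shift)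
open import Function using (_∘_)
open import Function.Bundles using (Equivalence)
open import Relation.Nullary using (¬_; yes; no)
open import Relation.Nullary.Decidable using (dec-true; dec-false)
open import Relation.Binary using (tri<; tri≈; tri>)
open import Relation.Binary.PropositionalEquality hiding ([_])
open ≡-Reasoning
open Equivalence using (to; from)

private
  toℚᵘ-/ : ∀ i d → toℚᵘ (i / suc d) ℚᵘ.≃ ℚᵘ.mkℚᵘ i d
  toℚᵘ-/ i d = toℚᵘ-fromℚᵘ (ℚᵘ.mkℚᵘ i d)

ℕtoℚ-homo-+ : ∀ a b → ℕtoℚ (a ℕ.+ b) ≡ ℕtoℚ a + ℕtoℚ b
ℕtoℚ-homo-+ a b = toℚᵘ-injective (ℚᵘ.≃-trans (toℚᵘ-/ (+ (a ℕ.+ b)) 0)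
  (ℚᵘ.≃-trans (ℚᵘ.*≡* cross) (ℚᵘ.≃-sym (ℚᵘ.≃-trans (toℚᵘ-homo-+ (ℕtoℚ a) (ℕtoℚ b))
    (ℚᵘ.+-cong (toℚᵘ-/ (+ a) 0) (toℚᵘ-/ (+ b) 0))))))
  where
  cross : + (a ℕ.+ b) ℤ.* + 1 ≡ (+ a ℤ.* + 1 ℤ.+ + b ℤ.* + 1) ℤ.* + 1
  cross = cong (ℤ._* + 1) (trans (ℤ.pos-+ a b)
    (sym (cong₂ ℤ._+_ (ℤ.*-identityʳ (+ a)) (ℤ.*-identityʳ (+ b)))))

ℕtoℚ-*-/ : ∀ a s d → (+ (a ℕ.* s)) / suc d ≡ ℕtoℚ a * ((+ s) / suc d)
ℕtoℚ-*-/ a s d = toℚᵘ-injective (ℚᵘ.≃-trans (toℚᵘ-/ (+ (a ℕ.* s)) d)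
  (ℚᵘ.≃-trans (ℚᵘ.*≡* (cong₂ ℤ._*_ (ℤ.pos-* a s) (cong (λ x → + suc x) (ℕ.+-identityʳ d))))
  (ℚᵘ.≃-sym (ℚᵘ.≃-trans (toℚᵘ-homo-* (ℕtoℚ a) ((+ s) / suc d))
    (ℚᵘ.*-cong (toℚᵘ-/ (+ a) 0) (toℚᵘ-/ (+ s) d))))))

ℕtoℚ-*-inverse : ∀ d → ℕtoℚ (suc d) * ((+ 1) / suc d) ≡ 1ℚ
ℕtoℚ-*-inverse d = toℚᵘ-injective (ℚᵘ.≃-trans (toℚᵘ-homo-* (ℕtoℚ (suc d)) ((+ 1) / suc d))
  (ℚᵘ.≃-trans (ℚᵘ.*-cong (toℚᵘ-/ (+ suc d) 0) (toℚᵘ-/ (+ 1) d))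
    (ℚᵘ.*≡* (cong (λ x → + suc x) d·1·1≡d+0+0))))
  where
  d·1·1≡d+0+0 : d ℕ.* 1 ℕ.* 1 ≡ d ℕ.+ 0 ℕ.+ 0
  d·1·1≡d+0+0 = trans (ℕ.*-identityʳ (d ℕ.* 1))
    (trans (ℕ.*-identityʳ d) (sym (trans (ℕ.+-identityʳ _) (ℕ.+-identityʳ d))))

module _ {A : Set} where

  sumℚ-map-cong-All : ∀ {P : A → Set} {f g : A → ℚ} {xs : List A} → All P xs →
    (∀ {x} → P x → f x ≡ g x) → sumℚ (map f xs) ≡ sumℚ (map g xs)
  sumℚ-map-cong-All []         f≗g = refl
  sumℚ-map-cong-All (px ∷ pxs) f≗g = cong₂ _+_ (f≗g px) (sumℚ-map-cong-All pxs f≗g)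

  sumℚ-map-cong : ∀ {f g : A → ℚ} (xs : List A) → (∀ x → f x ≡ g x) →
    sumℚ (map f xs) ≡ sumℚ (map g xs)
  sumℚ-map-cong []       f≗g = refl
  sumℚ-map-cong (x ∷ xs) f≗g = cong₂ _+_ (f≗g x) (sumℚ-map-cong xs f≗g)

  sumℚ-map-zero : ∀ (xs : List A) → sumℚ (map (λ _ → 0ℚ) xs) ≡ 0ℚ
  sumℚ-map-zero []       = refl
  sumℚ-map-zero (x ∷ xs) = trans (+-identityˡ _) (sumℚ-map-zero xs)

  sumℚ-map-+ : ∀ (f g : A → ℚ) (xs : List A) →
    sumℚ (map (λ x → f x + g x) xs) ≡ sumℚ (map f xs) + sumℚ (map g xs)
  sumℚ-map-+ f g []       = refl
  sumℚ-map-+ f g (x ∷ xs) = trans (cong (_+_ (f x + g x)) (sumℚ-map-+ f g xs))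
    (solve 4 (λ a b c d → (a :+ b) :+ (c :+ d) := (a :+ c) :+ (b :+ d)) refl
      (f x) (g x) (sumℚ (map f xs)) (sumℚ (map g xs)))
    where open +-*-Solver

  sumℚ-map-*ˡ : ∀ (a : ℚ) (f : A → ℚ) (xs : List A) →
    sumℚ (map (λ x → a * f x) xs) ≡ a * sumℚ (map f xs)
  sumℚ-map-*ˡ a f []       = sym (*-zeroʳ a)
  sumℚ-map-*ˡ a f (x ∷ xs) = trans (cong (_+_ (a * f x)) (sumℚ-map-*ˡ a f xs))
    (sym (*-distribˡ-+ a (f x) (sumℚ (map f xs))))

  sumℚ-map-filter : ∀ (p : A → Bool) (f : A → ℚ) (xs : List A) →
    sumℚ (map f (filter (λ x → p x ≟ᵇ true) xs))
      ≡ sumℚ (map (λ x → if p x then f x else 0ℚ) xs)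
  sumℚ-map-filter p f []       = refl
  sumℚ-map-filter p f (x ∷ xs) with p x
  ... | true  = cong (_+_ (f x)) (sumℚ-map-filter p f xs)
  ... | false = trans (sumℚ-map-filter p f xs) (sym (+-identityˡ _))

sumℚ-map-comm : ∀ {A B : Set} (h : A → B → ℚ) (xs : List A) (ys : List B) →
  sumℚ (map (λ x → sumℚ (map (h x) ys)) xs) ≡ sumℚ (map (λ y → sumℚ (map (λ x → h x y) xs)) ys)
sumℚ-map-comm h []       ys = sym (sumℚ-map-zero ys)
sumℚ-map-comm h (x ∷ xs) ys = trans (cong (_+_ (sumℚ (map (h x) ys))) (sumℚ-map-comm h xs ys))
  (sym (sumℚ-map-+ (h x) (λ y → sumℚ (map (λ x → h x y) xs)) ys))

∑-sumℚ-comm : ∀ {A : Set} {m} (h : Fin m → A → ℚ) (xs : List A) →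
  sum (λ j → sumℚ (map (h j) xs)) ≡ sumℚ (map (λ x → sum (λ j → h j x)) xs)
∑-sumℚ-comm {m = zero}  h xs = sym (sumℚ-map-zero xs)
∑-sumℚ-comm {m = suc m} h xs =
  trans (cong (_+_ (sumℚ (map (h zero) xs))) (∑-sumℚ-comm (h ∘ suc) xs))
        (sym (sumℚ-map-+ (h zero) (λ x → sum (λ j → h (suc j) x)) xs))

sumℚ-map-three-term : ∀ {A : Set} {P : A → Set} {xs : List A} → All P xs →
  ∀ (p q s : ℚ) (f g h d X : A → ℚ) →
  (∀ {x} → P x → p * f x ≡ q * g x + s * h x + d x) → (∀ {x} → P x → d x * X x ≡ 0ℚ) →
  p * sumℚ (map (λ x → f x * X x) xs)
    ≡ q * sumℚ (map (λ x → g x * X x) xs) + s * sumℚ (map (λ x → h x * X x) xs)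
sumℚ-map-three-term {P = P} {xs} Pxs p q s f g h d X combination negligible = begin
  p * sumℚ (map (λ x → f x * X x) xs)
    ≡⟨ sym (sumℚ-map-*ˡ p _ xs) ⟩
  sumℚ (map (λ x → p * (f x * X x)) xs)
    ≡⟨ sumℚ-map-cong-All Pxs pointwise ⟩
  sumℚ (map (λ x → q * (g x * X x) + s * (h x * X x)) xs)
    ≡⟨ sumℚ-map-+ _ _ xs ⟩
  sumℚ (map (λ x → q * (g x * X x)) xs) + sumℚ (map (λ x → s * (h x * X x)) xs)
    ≡⟨ cong₂ _+_ (sumℚ-map-*ˡ q _ xs) (sumℚ-map-*ˡ s _ xs) ⟩
  q * sumℚ (map (λ x → g x * X x) xs) + s * sumℚ (map (λ x → h x * X x) xs) ∎
  where
  pointwise : ∀ {x} → P x → p * (f x * X x) ≡ q * (g x * X x) + s * (h x * X x)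
  pointwise {x} Px = begin
    p * (f x * X x)                        ≡⟨ sym (*-assoc p (f x) (X x)) ⟩
    p * f x * X x                          ≡⟨ cong (_* X x) (combination Px) ⟩
    (q * g x + s * h x + d x) * X x        ≡⟨ *-distribʳ-+ (X x) (q * g x + s * h x) (d x) ⟩
    (q * g x + s * h x) * X x + d x * X x  ≡⟨ cong (_+_ ((q * g x + s * h x) * X x)) (negligible Px) ⟩
    (q * g x + s * h x) * X x + 0ℚ         ≡⟨ +-identityʳ _ ⟩
    (q * g x + s * h x) * X x              ≡⟨ *-distribʳ-+ (X x) (q * g x) (s * h x) ⟩
    q * g x * X x + s * h x * X x          ≡⟨ cong₂ _+_ (*-assoc q (g x) (X x)) (*-assoc s (h x) (X x)) ⟩
    q * (g x * X x) + s * (h x * X x)      ∎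

-- Hypersimplex classes

1/suc : ℕ → ℚ
1/suc n = + 1 / suc n

gamma-≡-⊓ : ∀ n k (S : Subset (suc n)) → k ≤ suc n →
  gamma n k S ≡ ℕtoℚ (k ⊓ ∣ S ∣) - ℕtoℚ k * (ℕtoℚ ∣ S ∣ * 1/suc n)
gamma-≡-⊓ n zero    S _       =
  sym (trans (cong (_-_ 0ℚ) (*-zeroˡ (ℕtoℚ ∣ S ∣ * 1/suc n))) (+-inverseʳ 0ℚ))
gamma-≡-⊓ n (suc k) S 1+k≤1+n with suc k <ᵇ suc n in eq
... | true  = cong (_-_ (ℕtoℚ (suc k ⊓ ∣ S ∣))) (trans (ℕtoℚ-*-/ (suc k) ∣ S ∣ n)
  (cong (ℕtoℚ (suc k) *_) (trans (cong (λ m → + m / suc n) (sym (ℕ.*-identityʳ ∣ S ∣)))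
                                 (ℕtoℚ-*-/ ∣ S ∣ 1 n))))
... | false = begin
  0ℚ
    ≡⟨ sym (+-inverseʳ (ℕtoℚ ∣ S ∣)) ⟩
  ℕtoℚ ∣ S ∣ - ℕtoℚ ∣ S ∣
    ≡⟨ cong₂ _-_ (cong ℕtoℚ (sym ⊓≡size)) (sym size≡) ⟩
  ℕtoℚ (suc k ⊓ ∣ S ∣) - ℕtoℚ (suc k) * (ℕtoℚ ∣ S ∣ * 1/suc n) ∎
  where
  k≡n : k ≡ n
  k≡n = ℕ.≤-antisym (ℕ.≤-pred 1+k≤1+n) (ℕ.≮⇒≥ λ k<n → subst T eq (ℕ.<⇒<ᵇ (ℕ.s<s k<n)))
  ⊓≡size : suc k ⊓ ∣ S ∣ ≡ ∣ S ∣
  ⊓≡size = ℕ.m≥n⇒m⊓n≡n (subst (λ m → ∣ S ∣ ≤ suc m) (sym k≡n) (∣p∣≤n S))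
  size≡ : ℕtoℚ (suc k) * (ℕtoℚ ∣ S ∣ * 1/suc n) ≡ ℕtoℚ ∣ S ∣
  size≡ rewrite k≡n = begin
    ℕtoℚ (suc n) * (ℕtoℚ ∣ S ∣ * 1/suc n)
      ≡⟨ solve 3 (λ a s ρ → a :* (s :* ρ) := s :* (a :* ρ)) refl (ℕtoℚ (suc n)) (ℕtoℚ ∣ S ∣) (1/suc n) ⟩
    ℕtoℚ ∣ S ∣ * (ℕtoℚ (suc n) * 1/suc n)
      ≡⟨ cong (ℕtoℚ ∣ S ∣ *_) (ℕtoℚ-*-inverse n) ⟩
    ℕtoℚ ∣ S ∣ * 1ℚ
      ≡⟨ *-identityʳ _ ⟩
    ℕtoℚ ∣ S ∣ ∎
    where open +-*-Solver

private
  affine-part-cancels : ∀ a b c mA mB mC y →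
    (c - a) * (mB - b * y)
      ≡ (b - a) * (mC - c * y) + (c - b) * (mA - a * y)
        + ((c - a) * mB - (b - a) * mC - (c - b) * mA)
  affine-part-cancels = solve 7 (λ a b c mA mB mC y →
    (c :- a) :* (mB :- b :* y)
      := (b :- a) :* (mC :- c :* y) :+ (c :- b) :* (mA :- a :* y)
         :+ ((c :- a) :* mB :- (b :- a) :* mC :- (c :- b) :* mA)) refl
    where open +-*-Solver

  no-kink-for-constant : ∀ a b c x → (c - a) * x - (b - a) * x - (c - b) * x ≡ 0ℚ
  no-kink-for-constant =
    solve 4 (λ a b c x → (c :- a) :* x :- (b :- a) :* x :- (c :- b) :* x := con 0ℚ) refl
    where open +-*-Solver

  no-kink-for-identity : ∀ a b c → (c - a) * b - (b - a) * c - (c - b) * a ≡ 0ℚ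
  no-kink-for-identity =
    solve 3 (λ a b c → (c :- a) :* b :- (b :- a) :* c :- (c :- b) :* a := con 0ℚ) refl
    where open +-*-Solver

module _ {A B C : ℕ} where

  private
    a b c : ℚ
    a = ℕtoℚ A
    b = ℕtoℚ B
    c = ℕtoℚ C

  -- How far k ↦ k ⊓ s is from being affine on A ≤ B ≤ C.
  ⊓-kink : ℕ → ℚ
  ⊓-kink s = (c - a) * ℕtoℚ (B ⊓ s) - (b - a) * ℕtoℚ (C ⊓ s) - (c - b) * ℕtoℚ (A ⊓ s)

  gamma-three-term : ∀ n (S : Subset (suc n)) → A ≤ B → B ≤ C → C ≤ suc n →
    (c - a) * gamma n B S ≡ (b - a) * gamma n C S + (c - b) * gamma n A S + ⊓-kink ∣ S ∣
  gamma-three-term n S A≤B B≤C C≤ = begin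
    (c - a) * gamma n B S
      ≡⟨ cong ((c - a) *_) (gamma-≡-⊓ n B S B≤) ⟩
    (c - a) * (ℕtoℚ (B ⊓ s) - b * y)
      ≡⟨ affine-part-cancels a b c (ℕtoℚ (A ⊓ s)) (ℕtoℚ (B ⊓ s)) (ℕtoℚ (C ⊓ s)) y ⟩
    (b - a) * (ℕtoℚ (C ⊓ s) - c * y) + (c - b) * (ℕtoℚ (A ⊓ s) - a * y) + ⊓-kink s
      ≡⟨ sym (cong₂ (λ γC γA → (b - a) * γC + (c - b) * γA + ⊓-kink s)
                    (gamma-≡-⊓ n C S C≤) (gamma-≡-⊓ n A S A≤)) ⟩
    (b - a) * gamma n C S + (c - b) * gamma n A S + ⊓-kink s ∎
    where
    s : ℕ
    s = ∣ S ∣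
    y : ℚ
    y = ℕtoℚ s * 1/suc n
    B≤ : B ≤ suc n
    B≤ = ℕ.≤-trans B≤C C≤
    A≤ : A ≤ suc n
    A≤ = ℕ.≤-trans A≤B B≤

  private
    ⊓-kink-at : ∀ {s mA mB mC} → A ⊓ s ≡ mA → B ⊓ s ≡ mB → C ⊓ s ≡ mC →
      ⊓-kink s ≡ (c - a) * ℕtoℚ mB - (b - a) * ℕtoℚ mC - (c - b) * ℕtoℚ mA
    ⊓-kink-at refl refl refl = refl

  ⊓-kink-≤ : ∀ {s} → A ≤ B → B ≤ C → s ≤ A → ⊓-kink s ≡ 0ℚ
  ⊓-kink-≤ {s} A≤B B≤C s≤A = begin
    ⊓-kink s
      ≡⟨ ⊓-kink-at (ℕ.m≥n⇒m⊓n≡n s≤A) (ℕ.m≥n⇒m⊓n≡n s≤B) (ℕ.m≥n⇒m⊓n≡n (ℕ.≤-trans s≤B B≤C)) ⟩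
    (c - a) * ℕtoℚ s - (b - a) * ℕtoℚ s - (c - b) * ℕtoℚ s
      ≡⟨ no-kink-for-constant a b c (ℕtoℚ s) ⟩
    0ℚ ∎
    where
    s≤B : s ≤ B
    s≤B = ℕ.≤-trans s≤A A≤B

  ⊓-kink-≥ : ∀ {s} → A ≤ B → B ≤ C → C ≤ s → ⊓-kink s ≡ 0ℚ
  ⊓-kink-≥ {s} A≤B B≤C C≤s = begin
    ⊓-kink s
      ≡⟨ ⊓-kink-at (ℕ.m≤n⇒m⊓n≡m (ℕ.≤-trans A≤B B≤s)) (ℕ.m≤n⇒m⊓n≡m B≤s) (ℕ.m≤n⇒m⊓n≡m C≤s) ⟩
    (c - a) * b - (b - a) * c - (c - b) * a
      ≡⟨ no-kink-for-identity a b c ⟩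
    0ℚ ∎
    where
    B≤s : B ≤ s
    B≤s = ℕ.≤-trans B≤C C≤s

-- Double counting

indicator : ∀ {m} → Fin m → Subset m → ℚ
indicator j S = if memᵇ j S then 1ℚ else 0ℚ

card≡∑indicator : ∀ {m} (S : Subset m) → ℕtoℚ ∣ S ∣ ≡ sum (λ j → indicator j S)
card≡∑indicator []          = refl
card≡∑indicator (true ∷ S)  = trans (ℕtoℚ-homo-+ 1 ∣ S ∣) (cong (_+_ 1ℚ) (card≡∑indicator S))
card≡∑indicator (false ∷ S) = trans (card≡∑indicator S) (sym (+-identityˡ _))

indicator-∩ : ∀ {m} j (S G : Subset m) → indicator j (S ∩ G) ≡ indicator j S * indicator j G
indicator-∩ j S G rewrite lookup-zipWith _∧_ j S G with memᵇ j S
... | true  = sym (*-identityˡ (indicator j G))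
... | false = sym (*-zeroˡ (indicator j G))

indicator-* : ∀ {m} j (S : Subset m) x → indicator j S * x ≡ (if memᵇ j S then x else 0ℚ)
indicator-* j S x with memᵇ j S
... | true  = *-identityˡ x
... | false = *-zeroˡ x

module _ {m} (L : List (Subset m)) (W : Subset m → ℚ) (α : ℚ)
         (incidence : ∀ j → sumℚ (map (λ G → indicator j G * W G) L) ≡ α) where

  sumℚ-card-∩ : ∀ S → sumℚ (map (λ G → ℕtoℚ ∣ S ∩ G ∣ * W G) L) ≡ α * ℕtoℚ ∣ S ∣
  sumℚ-card-∩ S = begin
    sumℚ (map (λ G → ℕtoℚ ∣ S ∩ G ∣ * W G) L)
      ≡⟨ sumℚ-map-cong L expand ⟩
    sumℚ (map (λ G → sum (λ j → indicator j S * (indicator j G * W G))) L)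
      ≡⟨ sym (∑-sumℚ-comm (λ j G → indicator j S * (indicator j G * W G)) L) ⟩
    sum (λ j → sumℚ (map (λ G → indicator j S * (indicator j G * W G)) L))
      ≡⟨ sum-cong-≗ (λ j → trans (sumℚ-map-*ˡ (indicator j S) _ L)
                                 (trans (cong (indicator j S *_) (incidence j)) (*-comm _ α))) ⟩
    sum (λ j → α * indicator j S)
      ≡⟨ sym (*-distribˡ-sum α (λ j → indicator j S)) ⟩
    α * sum (λ j → indicator j S)
      ≡⟨ cong (α *_) (sym (card≡∑indicator S)) ⟩
    α * ℕtoℚ ∣ S ∣ ∎
    where
    expand : ∀ G → ℕtoℚ ∣ S ∩ G ∣ * W G ≡ sum (λ j → indicator j S * (indicator j G * W G))
    expand G = begin
      ℕtoℚ ∣ S ∩ G ∣ * W G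
        ≡⟨ cong (_* W G) (card≡∑indicator (S ∩ G)) ⟩
      sum (λ j → indicator j (S ∩ G)) * W G
        ≡⟨ *-distribʳ-sum (W G) (λ j → indicator j (S ∩ G)) ⟩
      sum (λ j → indicator j (S ∩ G) * W G)
        ≡⟨ sum-cong-≗ (λ j → trans (cong (_* W G) (indicator-∩ j S G))
                                   (*-assoc (indicator j S) (indicator j G) (W G))) ⟩
      sum (λ j → indicator j S * (indicator j G * W G)) ∎

⊓-card≡card-∩ : ∀ {m} {F G : Subset m} → F ⊆ G ⊎ G ⊆ F → ∣ F ∣ ⊓ ∣ G ∣ ≡ ∣ F ∩ G ∣
⊓-card≡card-∩ {F = F} {G} (inj₁ F⊆G) = trans (ℕ.m≤n⇒m⊓n≡m (p⊆q⇒∣p∣≤∣q∣ F⊆G))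
  (cong ∣_∣ (⊆-antisym (λ x∈F → x∈p∩q⁺ (x∈F , F⊆G x∈F)) (p∩q⊆p F G)))
⊓-card≡card-∩ {F = F} {G} (inj₂ G⊆F) = trans (ℕ.m≥n⇒m⊓n≡n (p⊆q⇒∣p∣≤∣q∣ G⊆F))
  (cong ∣_∣ (⊆-antisym (λ x∈G → x∈p∩q⁺ (G⊆F x∈G , x∈G)) (p∩q⊆q F G)))

gamma-card-weighted-sum≡0 : ∀ {n} {P : Subset (suc n) → Set} {L : List (Subset (suc n))} →
  All P L → (F : Subset (suc n)) (W : Subset (suc n) → ℚ) (α : ℚ) →
  (∀ {G} → P G → ¬ F ⊆ G → ¬ G ⊆ F → W G ≡ 0ℚ) →
  (∀ j → sumℚ (map (λ G → indicator j G * W G) L) ≡ α) →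
  sumℚ (map (λ G → gamma n ∣ F ∣ G * W G) L) ≡ 0ℚ
gamma-card-weighted-sum≡0 {n} {P} {L} PL F W α incomparable incidence = begin
  sumℚ (map (λ G → gamma n ∣ F ∣ G * W G) L)
    ≡⟨ sumℚ-map-cong-All PL split ⟩
  sumℚ (map (λ G → ℕtoℚ ∣ F ∩ G ∣ * W G + c * (ℕtoℚ ∣ ⊤ ∩ G ∣ * W G)) L)
    ≡⟨ sumℚ-map-+ _ _ L ⟩
  sumℚ (map (λ G → ℕtoℚ ∣ F ∩ G ∣ * W G) L) + sumℚ (map (λ G → c * (ℕtoℚ ∣ ⊤ ∩ G ∣ * W G)) L)
    ≡⟨ cong₂ _+_ (sumℚ-card-∩ L W α incidence F)
                 (trans (sumℚ-map-*ˡ c _ L) (cong (c *_) (sumℚ-card-∩ L W α incidence ⊤))) ⟩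
  α * f + c * (α * ℕtoℚ ∣ ⊤ {suc n} ∣)
    ≡⟨ cong (λ N → α * f + c * (α * ℕtoℚ N)) (∣⊤∣≡n (suc n)) ⟩
  α * f + c * (α * ℕtoℚ (suc n))
    ≡⟨ solve 4 (λ α f ρ N → α :* f :+ (:- (f :* ρ)) :* (α :* N) := α :* f :* (con 1ℚ :- N :* ρ))
         refl α f ρ (ℕtoℚ (suc n)) ⟩
  α * f * (1ℚ - ℕtoℚ (suc n) * ρ)
    ≡⟨ cong (λ x → α * f * (1ℚ - x)) (ℕtoℚ-*-inverse n) ⟩
  α * f * (1ℚ - 1ℚ)
    ≡⟨ cong (α * f *_) (+-inverseʳ 1ℚ) ⟩
  α * f * 0ℚ
    ≡⟨ *-zeroʳ (α * f) ⟩
  0ℚ ∎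
  where
  open +-*-Solver
  f ρ c : ℚ
  f = ℕtoℚ ∣ F ∣
  ρ = 1/suc n
  c = ℚ.- (f * ρ)
  split : ∀ {G} → P G → (gamma n ∣ F ∣ G) * W G ≡ ℕtoℚ ∣ F ∩ G ∣ * W G + c * (ℕtoℚ ∣ ⊤ ∩ G ∣ * W G)
  split {G} PG = begin
    (gamma n ∣ F ∣ G) * W G
      ≡⟨ cong (_* W G) (gamma-≡-⊓ n ∣ F ∣ G (∣p∣≤n F)) ⟩
    (ℕtoℚ (∣ F ∣ ⊓ ∣ G ∣) - f * (ℕtoℚ ∣ G ∣ * ρ)) * W G
      ≡⟨ solve 5 (λ m f g ρ w → (m :- f :* (g :* ρ)) :* w := m :* w :+ (:- (f :* ρ)) :* (g :* w))
           refl (ℕtoℚ (∣ F ∣ ⊓ ∣ G ∣)) f (ℕtoℚ ∣ G ∣) ρ (W G) ⟩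
    ℕtoℚ (∣ F ∣ ⊓ ∣ G ∣) * W G + c * (ℕtoℚ ∣ G ∣ * W G)
      ≡⟨ cong₂ _+_ ⊓≡card-∩ (cong (λ S → c * (ℕtoℚ ∣ S ∣ * W G)) (sym (∩-identityˡ G))) ⟩
    ℕtoℚ ∣ F ∩ G ∣ * W G + c * (ℕtoℚ ∣ ⊤ ∩ G ∣ * W G) ∎
    where
    ⊓≡card-∩ : ℕtoℚ (∣ F ∣ ⊓ ∣ G ∣) * W G ≡ ℕtoℚ ∣ F ∩ G ∣ * W G
    ⊓≡card-∩ with F ⊆? G | G ⊆? F
    ... | yes F⊆G | _       = cong (λ k → ℕtoℚ k * W G) (⊓-card≡card-∩ (inj₁ F⊆G))
    ... | no _    | yes G⊆F = cong (λ k → ℕtoℚ k * W G) (⊓-card≡card-∩ (inj₂ G⊆F))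
    ... | no F⊈G  | no G⊈F  rewrite incomparable PG F⊈G G⊈F =
      trans (*-zeroʳ (ℕtoℚ (∣ F ∣ ⊓ ∣ G ∣))) (sym (*-zeroʳ (ℕtoℚ ∣ F ∩ G ∣)))

module _ {m} {P : Subset m → Set} {L : List (Subset m)} (PL : All P L) where

  AgreeOn : ℕ → (D₁ D₂ : List (Subset m) → ℚ) → Set
  AgreeOn k D₁ D₂ = ∀ ms → All P ms → length ms ≡ k → D₁ ms ≡ D₂ ms

  SymmetricOn : ℕ → (List (Subset m) → ℚ) → Set
  SymmetricOn k D = ∀ ms ms′ → All P ms → length ms ≡ k → ms ↭ ms′ → D ms ≡ D ms′

  AgreeOn-∷ : ∀ {k D₁ D₂ F} → P F → AgreeOn (suc k) D₁ D₂ → AgreeOn k (D₁ ∘ (F ∷_)) (D₂ ∘ (F ∷_))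
  AgreeOn-∷ PF agree ms Pms len = agree (_ ∷ ms) (PF ∷ Pms) (cong suc len)

  SymmetricOn-∷ : ∀ {k D F} → P F → SymmetricOn (suc k) D → SymmetricOn k (D ∘ (F ∷_))
  SymmetricOn-∷ PF sym-D ms ms′ Pms len p =
    sym-D (_ ∷ ms) (_ ∷ ms′) (PF ∷ Pms) (cong suc len) (↭.prep _ p)

  evalProd-cong : ∀ ls {D₁ D₂} → AgreeOn (length ls) D₁ D₂ → evalProd L D₁ ls ≡ evalProd L D₂ ls
  evalProd-cong []       agree = agree [] [] refl
  evalProd-cong (ℓ ∷ ls) agree =
    sumℚ-map-cong-All PL (λ PF → cong (ℓ _ *_) (evalProd-cong ls (AgreeOn-∷ PF agree)))

  evalProd-zero : ∀ ls {D} → AgreeOn (length ls) D (λ _ → 0ℚ) → evalProd L D ls ≡ 0ℚ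
  evalProd-zero []       vanish = vanish [] [] refl
  evalProd-zero (ℓ ∷ ls) vanish = trans
    (sumℚ-map-cong-All PL (λ {F} PF →
      trans (cong (ℓ F *_) (evalProd-zero ls (AgreeOn-∷ PF vanish))) (*-zeroʳ (ℓ F))))
    (sumℚ-map-zero L)

  evalProd-sumℚ : ∀ {A : Set} ls (Gs : List A) (Dᵍ : A → List (Subset m) → ℚ) →
    evalProd L (λ ms → sumℚ (map (λ G → Dᵍ G ms) Gs)) ls
      ≡ sumℚ (map (λ G → evalProd L (Dᵍ G) ls) Gs)
  evalProd-sumℚ []       Gs Dᵍ = refl
  evalProd-sumℚ (ℓ ∷ ls) Gs Dᵍ = trans
    (sumℚ-map-cong L (λ F → trans (cong (ℓ F *_) (evalProd-sumℚ ls Gs (λ G → Dᵍ G ∘ (F ∷_))))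
                                  (sym (sumℚ-map-*ˡ (ℓ F) _ Gs))))
    (sumℚ-map-comm (λ F G → ℓ F * evalProd L (Dᵍ G ∘ (F ∷_)) ls) L Gs)

  evalProd-swap : ∀ ℓ₁ ℓ₂ ls {D} → SymmetricOn (suc (suc (length ls))) D →
    evalProd L D (ℓ₁ ∷ ℓ₂ ∷ ls) ≡ evalProd L D (ℓ₂ ∷ ℓ₁ ∷ ls)
  evalProd-swap ℓ₁ ℓ₂ ls {D} sym-D = begin
    evalProd L D (ℓ₁ ∷ ℓ₂ ∷ ls)
      ≡⟨ sumℚ-map-cong-All PL (λ {F} PF → cong (ℓ₁ F *_) (sumℚ-map-cong-All PL (λ {G} PG →
           cong (ℓ₂ G *_) (evalProd-cong ls (λ ms Pms len → sym-D (F ∷ G ∷ ms) (G ∷ F ∷ ms)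
             (PF ∷ PG ∷ Pms) (cong (λ k → suc (suc k)) len) (↭.swap F G ↭.↭-refl)))))) ⟩
    sumℚ (map (λ F → ℓ₁ F * sumℚ (map (λ G → ℓ₂ G * D′ G F) L)) L)
      ≡⟨ sumℚ-map-cong L (λ F → sym (sumℚ-map-*ˡ (ℓ₁ F) _ L)) ⟩
    sumℚ (map (λ F → sumℚ (map (λ G → ℓ₁ F * (ℓ₂ G * D′ G F)) L)) L)
      ≡⟨ sumℚ-map-comm (λ F G → ℓ₁ F * (ℓ₂ G * D′ G F)) L L ⟩
    sumℚ (map (λ G → sumℚ (map (λ F → ℓ₁ F * (ℓ₂ G * D′ G F)) L)) L)
      ≡⟨ sumℚ-map-cong L (λ G → trans (sumℚ-map-cong L (λ F → exchange (ℓ₁ F) (ℓ₂ G) (D′ G F)))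
                                       (sumℚ-map-*ˡ (ℓ₂ G) _ L)) ⟩
    evalProd L D (ℓ₂ ∷ ℓ₁ ∷ ls) ∎
    where
    open +-*-Solver
    D′ : Subset m → Subset m → ℚ
    D′ G F = evalProd L (λ ms → D (G ∷ F ∷ ms)) ls
    exchange : ∀ a b c → a * (b * c) ≡ b * (a * c)
    exchange = solve 3 (λ a b c → a :* (b :* c) := b :* (a :* c)) refl

  evalProd-↭ : ∀ {ls ls′ D} → SymmetricOn (length ls) D → ls ↭ ls′ →
    evalProd L D ls ≡ evalProd L D ls′
  evalProd-↭ sym-D ↭.refl = refl
  evalProd-↭ sym-D (↭.prep ℓ p) =
    sumℚ-map-cong-All PL (λ PF → cong (ℓ _ *_) (evalProd-↭ (SymmetricOn-∷ PF sym-D) p))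
  evalProd-↭ {D = D} sym-D (↭.swap {ys = ls′} ℓ₁ ℓ₂ p) = trans
    (sumℚ-map-cong-All PL (λ PF → cong (ℓ₁ _ *_) (sumℚ-map-cong-All PL (λ PG → cong (ℓ₂ _ *_)
      (evalProd-↭ (SymmetricOn-∷ PG (SymmetricOn-∷ PF sym-D)) p)))))
    (evalProd-swap ℓ₁ ℓ₂ ls′ (subst (λ k → SymmetricOn (suc (suc k)) D) (↭-length p) sym-D))
  evalProd-↭ sym-D (↭.trans p q) =
    trans (evalProd-↭ sym-D p) (evalProd-↭ (subst (λ k → SymmetricOn k _) (↭-length p) sym-D) q)

module _ {X : Set} (g : ℕ → X) where

  factorList : List ℕ → (ℕ → ℕ) → List X
  factorList ks c = concat (map (λ k → replicate (c k) (g k)) ks)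

  factorList-cong : ∀ {ks c c′} → All (λ k → c k ≡ c′ k) ks → factorList ks c ≡ factorList ks c′
  factorList-cong []          = refl
  factorList-cong (ck≡ ∷ c≡) = cong₂ _++_ (cong (λ x → replicate x (g _)) ck≡) (factorList-cong c≡)

  factorList-↭ : ∀ {ks c c′ b} → Unique ks → b ∈ˡ ks →
    c b ≡ suc (c′ b) → (∀ k → k ≢ b → c k ≡ c′ k) → factorList ks c ↭ g b ∷ factorList ks c′
  factorList-↭ {k ∷ ks} {c} {c′} (k∉ks ∷ _) (here refl) cb≡ c≡ rewrite cb≡ =
    ↭.prep (g k) (subst (λ l → replicate (c′ k) (g k) ++ factorList ks c ↭ replicate (c′ k) (g k) ++ l)
      (factorList-cong (All.map (λ k≢k′ → c≡ _ (λ eq → k≢k′ (sym eq))) k∉ks)) ↭.↭-refl)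
  factorList-↭ {k ∷ ks} {c} {c′} {b} (k∉ks ∷ ks-unique) (there b∈ks) cb≡ c≡
    rewrite c≡ k (All.lookup k∉ks b∈ks) =
    ↭.trans (++⁺ˡ (replicate (c′ k) (g k)) (factorList-↭ ks-unique b∈ks cb≡ c≡))
            (↭-shift (g b) (replicate (c′ k) (g k)) (factorList ks c′))

  length-factorList : ∀ ks c → length (factorList ks c) ≡ ℕ.sum (map c ks)
  length-factorList []       c = refl
  length-factorList (k ∷ ks) c = trans (length-++ (replicate (c k) (g k)))
    (cong₂ ℕ._+_ (length-replicate (c k)) (length-factorList ks c))

sum-upTo≡sumRange : ∀ (c : ℕ → ℕ) k → ℕ.sum (map c (upTo (suc k))) ≡ c 0 ℕ.+ sumRange c k
sum-upTo≡sumRange c zero    = refl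
sum-upTo≡sumRange c (suc k) = begin
  ℕ.sum (map c (upTo (suc (suc k))))             ≡⟨ cong (ℕ.sum ∘ map c) (sym (upTo-∷ʳ (suc k))) ⟩
  ℕ.sum (map c (upTo (suc k) ++ [ suc k ]))      ≡⟨ cong ℕ.sum (map-++ c (upTo (suc k)) [ suc k ]) ⟩
  ℕ.sum (map c (upTo (suc k)) ++ [ c (suc k) ])  ≡⟨ ℕ.sum-++ (map c (upTo (suc k))) [ c (suc k) ] ⟩
  ℕ.sum (map c (upTo (suc k))) ℕ.+ (c (suc k) ℕ.+ 0)
    ≡⟨ cong₂ ℕ._+_ (sum-upTo≡sumRange c k) (ℕ.+-identityʳ (c (suc k))) ⟩
  c 0 ℕ.+ sumRange c k ℕ.+ c (suc k)             ≡⟨ ℕ.+-assoc (c 0) (sumRange c k) (c (suc k)) ⟩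
  c 0 ℕ.+ sumRange c (suc k)                     ∎

length-gammaFactors : ∀ n c → length (gammaFactors n c) ≡ c 0 ℕ.+ sumRange c (suc n)
length-gammaFactors n c =
  trans (length-factorList (gamma n) (upTo (suc (suc n))) c) (sum-upTo≡sumRange c (suc n))

length-gammaFactors≡ : ∀ {n r c} → c 0 ≡ 0 → (∀ k → suc n ≤ k → c k ≡ 0) → sumRange c n ≡ r →
  length (gammaFactors n c) ≡ r
length-gammaFactors≡ {n} {r} {c} c₀≡0 c-vanishes Σc≡r = begin
  length (gammaFactors n c)             ≡⟨ length-gammaFactors n c ⟩
  c 0 ℕ.+ (sumRange c n ℕ.+ c (suc n))
    ≡⟨ cong₂ (λ x y → x ℕ.+ (sumRange c n ℕ.+ y)) c₀≡0 (c-vanishes (suc n) ℕ.≤-refl) ⟩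
  sumRange c n ℕ.+ 0                    ≡⟨ ℕ.+-identityʳ _ ⟩
  sumRange c n                          ≡⟨ Σc≡r ⟩
  r                                     ∎

support≤ : ∀ {n b} {c : ℕ → ℕ} → (∀ k → suc n ≤ k → c k ≡ 0) → 1 ≤ c b → b ≤ n
support≤ {b = b} c-vanishes 1≤cb = ℕ.≮⇒≥ (λ n<b → ℕ.<⇒≱ (subst (1 ≤_) (c-vanishes b n<b) 1≤cb) z≤n)

gammaFactors-↭ : ∀ n {c c′ b} → b ≤ suc n →
  c b ≡ suc (c′ b) → (∀ k → k ≢ b → c k ≡ c′ k) → gammaFactors n c ↭ gamma n b ∷ gammaFactors n c′
gammaFactors-↭ n b≤ = factorList-↭ (gamma n) (upTo⁺ _) (∈-upTo⁺ (s≤s b≤))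

-- c − e_b; note that shift c b x is pointwise, by definition, e_x + lower c b.
lower : (ℕ → ℕ) → ℕ → (ℕ → ℕ)
lower c b k = if k ≡ᵇ b then c k ∸ 1 else c k

module _ (c : ℕ → ℕ) (b : ℕ) where

  lower-≢ : ∀ k → k ≢ b → c k ≡ lower c b k
  lower-≢ k k≢b = cong (λ t → if t then c k ∸ 1 else c k) (sym (dec-false (k ℕ.≟ b) k≢b))

  lower-≡ : 1 ≤ c b → c b ≡ suc (lower c b b)
  lower-≡ 1≤cb = trans (sym (ℕ.m+[n∸m]≡n 1≤cb))
    (cong (λ t → suc (if t then c b ∸ 1 else c b)) (sym (dec-true (b ℕ.≟ b) refl)))

  shift-≢ : ∀ x k → k ≢ x → shift c b x k ≡ lower c b k
  shift-≢ x k k≢x = cong (λ t → (if t then 1 else 0) ℕ.+ lower c b k) (dec-false (k ℕ.≟ x) k≢x)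

  shift-≡ : ∀ x → shift c b x x ≡ suc (lower c b x)
  shift-≡ x = cong (λ t → (if t then 1 else 0) ℕ.+ lower c b x) (dec-true (x ℕ.≟ x) refl)

module _ (n : ℕ) (c : ℕ → ℕ) {b : ℕ} (2≤cb : 2 ≤ c b) (b≤ : b ≤ suc n) where

  private
    1≤cb : 1 ≤ c b
    1≤cb = ℕ.≤-trans (s≤s z≤n) 2≤cb

    lower-once : gammaFactors n (lower c b) ↭ gamma n b ∷ gammaFactors n (lower (lower c b) b)
    lower-once = gammaFactors-↭ n b≤
      (lower-≡ (lower c b) b (ℕ.≤-pred (subst (2 ≤_) (lower-≡ c b 1≤cb) 2≤cb)))
      (lower-≢ (lower c b) b)

  gammaFactors-↭-twice :
    gammaFactors n c ↭ gamma n b ∷ gamma n b ∷ gammaFactors n (lower (lower c b) b)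
  gammaFactors-↭-twice = ↭.trans (gammaFactors-↭ n b≤ (lower-≡ c b 1≤cb) (lower-≢ c b))
                                 (↭.prep (gamma n b) lower-once)

  gammaFactors-↭-shift : ∀ {x} → x ≤ suc n →
    gammaFactors n (shift c b x) ↭ gamma n x ∷ gamma n b ∷ gammaFactors n (lower (lower c b) b)
  gammaFactors-↭-shift {x} x≤ = ↭.trans (gammaFactors-↭ n x≤ (shift-≡ c b x) (shift-≢ c b x))
                                        (↭.prep (gamma n x) lower-once)

-- Flats of a simple perfect matroid design

module _ {m} (rk : Subset m → ℕ) where

  flat-closed : ∀ {F} → IsFlat rk F → ∀ e → e ∉ F → rk F < rk (F ∪ ⁅ e ⁆)
  flat-closed {F} flat e e∉F with to T-∨ (All.lookup (all⁺ _ (allFin m) (from T-≡ flat)) (∈-allFin e))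
  ... | inj₁ e∈F = ⊥-elim (e∉F (lookup⇒[]= e F (to T-≡ e∈F)))
  ... | inj₂ rk< = ℕ.<ᵇ⇒< _ _ rk<

  flat-intro : ∀ {F} → (∀ e → e ∈ F ⊎ rk F < rk (F ∪ ⁅ e ⁆)) → IsFlat rk F
  flat-intro {F} closed =
    to T-≡ (all⁻ _ {xs = allFin m} (All.tabulate (λ {e} _ → from T-∨ (decode (closed e)))))
    where
    decode : ∀ {e} → e ∈ F ⊎ rk F < rk (F ∪ ⁅ e ⁆) → T (memᵇ e F) ⊎ T (rk F <ᵇ rk (F ∪ ⁅ e ⁆))
    decode (inj₁ e∈F) = inj₁ (from T-≡ ([]=⇒lookup e∈F))
    decode (inj₂ rk<) = inj₂ (ℕ.<⇒<ᵇ rk<)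

  npFlat⁻ : ∀ {F} → IsNPFlat rk F → 0 < ∣ F ∣ × ∣ F ∣ < m × IsFlat rk F
  npFlat⁻ np with to T-∧ (from T-≡ np)
  ... | np′ , flat with to T-∧ np′
  ...   | 0< , <m = ℕ.<ᵇ⇒< _ _ 0< , ℕ.<ᵇ⇒< _ _ <m , to T-≡ flat

module SPMD {n r rk ns} (spmd : IsSPMD n r rk ns) where

  open IsSPMD spmd
  open IsMatroid matroid

  rk-∪-⁅⁆ : ∀ X e → rk (X ∪ ⁅ e ⁆) ≤ suc (rk X)
  rk-∪-⁅⁆ X e = subst (rk (X ∪ ⁅ e ⁆) ≤_)
    (trans (cong (rk X ℕ.+_) (proj₁ simple e)) (ℕ.+-comm (rk X) 1))
    (ℕ.m+n≤o⇒m≤o (rk (X ∪ ⁅ e ⁆)) (rk-submod X ⁅ e ⁆))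

  ∃-∉ : ∀ {F} → ¬ (⊤ ⊆ F) → ∃ λ e → e ∉ F
  ∃-∉ {F} ⊤⊈F = ¬∀⟶∃¬ (suc n) _ (_∈? F) (λ all∈ → ⊤⊈F (λ {e} _ → all∈ e))

  npFlat-rk-pos : ∀ {F} → IsNPFlat rk F → 1 ≤ rk F
  npFlat-rk-pos {F} np with nonempty? F
  ... | yes (e , e∈F) = subst (_≤ rk F) (proj₁ simple e)
          (rk-mono ⁅ e ⁆ F (λ {x} x∈⁅e⁆ → subst (_∈ F) (sym (x∈⁅y⁆⇒x≡y e x∈⁅e⁆)) e∈F))
  ... | no  empty     = ⊥-elim (ℕ.<-irrefl
          (sym (trans (cong ∣_∣ (Empty-unique empty)) (∣⊥∣≡0 (suc n)))) (proj₁ (npFlat⁻ rk {F} np)))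

  npFlat-rk≤ : ∀ {F} → IsNPFlat rk F → rk F ≤ r
  npFlat-rk≤ {F} np with npFlat⁻ rk np
  ... | _ , ∣F∣< , flat = ℕ.≤-pred (ℕ.≤∧≢⇒< (subst (rk F ≤_) rank (rk-mono F ⊤ ⊆⊤)) not-top)
    where
    not-top : rk F ≢ suc r
    not-top rkF≡
      with ∃-∉ (λ ⊤⊆F → ℕ.<⇒≱ ∣F∣< (subst (_≤ ∣ F ∣) (∣⊤∣≡n (suc n)) (p⊆q⇒∣p∣≤∣q∣ {p = ⊤} ⊤⊆F)))
    ... | e , e∉F = ℕ.<⇒≱ (flat-closed rk flat e e∉F)
                          (subst (rk (F ∪ ⁅ e ⁆) ≤_) (trans rank (sym rkF≡)) (rk-mono (F ∪ ⁅ e ⁆) ⊤ ⊆⊤))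

  npFlat-size : ∀ {F} → IsNPFlat rk F → ∣ F ∣ ≡ ns (rk F)
  npFlat-size np = ns-sizes _ (npFlat-rk-pos np) (npFlat-rk≤ np) _ (proj₂ (proj₂ (npFlat⁻ rk np))) refl

  ns-mono-< : ∀ {j j′} → 1 ≤ j → j < j′ → j′ ≤ r → ns j < ns j′
  ns-mono-< {j} {suc j″} 1≤j (s≤s j≤j″) j′≤r with j ℕ.≟ j″
  ... | yes refl = ns-incr j 1≤j j′≤r
  ... | no  j≢j″ = ℕ.<-trans (ns-mono-< 1≤j (ℕ.≤∧≢⇒< j≤j″ j≢j″) (ℕ.<⇒≤ j′≤r))
                             (ns-incr j″ (ℕ.≤-trans 1≤j j≤j″) j′≤r)

  ns-mono-≤ : ∀ {j j′} → 1 ≤ j → j ≤ j′ → j′ ≤ r → ns j ≤ ns j′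
  ns-mono-≤ {j} {j′} 1≤j j≤j′ j′≤r with j ℕ.≟ j′
  ... | yes refl = ℕ.≤-refl
  ... | no  j≢j′ = ℕ.<⇒≤ (ns-mono-< 1≤j (ℕ.≤∧≢⇒< j≤j′ j≢j′) j′≤r)

  greedy : ℕ → Subset (suc n) → List (Fin (suc n)) → Subset (suc n)
  greedy k X []       = X
  greedy k X (e ∷ es) with rk (X ∪ ⁅ e ⁆) ≤? k
  ... | yes _ = greedy k (X ∪ ⁅ e ⁆) es
  ... | no  _ = greedy k X es

  greedy-rk≤ : ∀ k X es → rk X ≤ k → rk (greedy k X es) ≤ k
  greedy-rk≤ k X []       rkX≤ = rkX≤
  greedy-rk≤ k X (e ∷ es) rkX≤ with rk (X ∪ ⁅ e ⁆) ≤? k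
  ... | yes rk≤ = greedy-rk≤ k (X ∪ ⁅ e ⁆) es rk≤
  ... | no  _   = greedy-rk≤ k X es rkX≤

  greedy-⊇ : ∀ k X es → X ⊆ greedy k X es
  greedy-⊇ k X []       = λ x∈X → x∈X
  greedy-⊇ k X (e ∷ es) with rk (X ∪ ⁅ e ⁆) ≤? k
  ... | yes _ = λ x∈X → greedy-⊇ k (X ∪ ⁅ e ⁆) es (p⊆p∪q ⁅ e ⁆ x∈X)
  ... | no  _ = greedy-⊇ k X es

  greedy-maximal : ∀ k X es e → e ∈ˡ es → e ∈ greedy k X es ⊎ k < rk (greedy k X es ∪ ⁅ e ⁆)
  greedy-maximal k X (e ∷ es) .e (here refl) with rk (X ∪ ⁅ e ⁆) ≤? k
  ... | yes _   = inj₁ (greedy-⊇ k (X ∪ ⁅ e ⁆) es (q⊆p∪q X ⁅ e ⁆ (x∈⁅x⁆ e)))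
  ... | no  rk≰ = inj₂ (ℕ.<-≤-trans (ℕ.≰⇒> rk≰) (rk-mono _ _ X∪e⊆))
    where
    X∪e⊆ : X ∪ ⁅ e ⁆ ⊆ greedy k X es ∪ ⁅ e ⁆
    X∪e⊆ x∈ with x∈p∪q⁻ X ⁅ e ⁆ x∈
    ... | inj₁ x∈X = x∈p∪q⁺ (inj₁ (greedy-⊇ k X es x∈X))
    ... | inj₂ x∈e = x∈p∪q⁺ (inj₂ x∈e)
  greedy-maximal k X (e′ ∷ es) e (there e∈es) with rk (X ∪ ⁅ e′ ⁆) ≤? k
  ... | yes _ = greedy-maximal k (X ∪ ⁅ e′ ⁆) es e e∈es
  ... | no  _ = greedy-maximal k X es e e∈es

  ∃-flat-of-rank : ∀ {k} → k ≤ r → ∃ λ F → IsFlat rk F × rk F ≡ k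
  ∃-flat-of-rank {k} k≤r = F , flat , ℕ.≤-antisym rkF≤k k≤rkF
    where
    F : Subset (suc n)
    F = greedy k ⊥ (allFin (suc n))
    rkF≤k : rk F ≤ k
    rkF≤k = greedy-rk≤ k ⊥ _ (ℕ.≤-trans (rk-bound ⊥) (subst (_≤ k) (sym (∣⊥∣≡0 (suc n))) z≤n))
    flat : IsFlat rk F
    flat = flat-intro rk (λ e → map₂ (ℕ.≤-<-trans rkF≤k) (greedy-maximal k ⊥ _ e (∈-allFin e)))
    k≤rkF : k ≤ rk F
    k≤rkF
      with ∃-∉ (λ ⊤⊆F → ℕ.<⇒≱ (ℕ.≤-<-trans rkF≤k (s≤s k≤r)) (subst (_≤ rk F) rank (rk-mono ⊤ F ⊤⊆F)))
    ... | e , e∉F with greedy-maximal k ⊥ _ e (∈-allFin e)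
    ...   | inj₁ e∈F = ⊥-elim (e∉F e∈F)
    ...   | inj₂ k<  = ℕ.≤-pred (ℕ.<-≤-trans k< (rk-∪-⁅⁆ F e))

  ns≤suc-n : ∀ {j} → 1 ≤ j → j ≤ r → ns j ≤ suc n
  ns≤suc-n {j} 1≤j j≤r with ∃-flat-of-rank j≤r
  ... | F , flat , rkF≡j = subst (_≤ suc n) (ns-sizes j 1≤j j≤r F flat rkF≡j) (∣p∣≤n F)

  ns-pred<ns : ∀ {i} → 1 ≤ i → i ≤ r → ns (i ∸ 1) < ns i
  ns-pred<ns {suc zero}    _ _   = subst₂ _<_ (sym ns-zero) (sym ns-one) (s≤s z≤n)
  ns-pred<ns {suc (suc j)} _ i≤r = ns-incr (suc j) (s≤s z≤n) i≤r

  ns<ns-suc : ∀ {i} → 1 ≤ i → i ≤ r → ns i ≤ n → ns i < ns (suc i)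
  ns<ns-suc {i} 1≤i i≤r nsi≤n with i ℕ.≟ r
  ... | yes refl = subst (ns i <_) (sym ns-top) (s≤s nsi≤n)
  ... | no  i≢r  = ns-incr i 1≤i (ℕ.≤∧≢⇒< i≤r i≢r)

  ns-suc≤suc-n : ∀ {i} → i ≤ r → ns (suc i) ≤ suc n
  ns-suc≤suc-n {i} i≤r with i ℕ.≟ r
  ... | yes refl = ℕ.≤-reflexive ns-top
  ... | no  i≢r  = ns≤suc-n (s≤s z≤n) (ℕ.≤∧≢⇒< i≤r i≢r)

  npFlat-size-trichotomy : ∀ {i F} → 1 ≤ i → i ≤ r → IsNPFlat rk F →
    ∣ F ∣ ≤ ns (i ∸ 1) ⊎ ∣ F ∣ ≡ ns i ⊎ ns (suc i) ≤ ∣ F ∣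
  npFlat-size-trichotomy {i} {F} 1≤i i≤r np =
    subst (λ s → s ≤ ns (i ∸ 1) ⊎ s ≡ ns i ⊎ ns (suc i) ≤ s) (sym (npFlat-size {F} np)) by-rank
    where
    by-rank : ns (rk F) ≤ ns (i ∸ 1) ⊎ ns (rk F) ≡ ns i ⊎ ns (suc i) ≤ ns (rk F)
    by-rank with ℕ.<-cmp (rk F) i
    ... | tri< rk<i _ _ = inj₁ (ns-mono-≤ (npFlat-rk-pos {F} np)
            (ℕ.≤-pred (ℕ.<-≤-trans rk<i (ℕ.≤-reflexive (sym (ℕ.suc-pred i {{ℕ.>-nonZero 1≤i}})))))
            (ℕ.≤-trans (ℕ.m∸n≤m i 1) i≤r))
    ... | tri≈ _ rk≡i _ = inj₂ (inj₁ (cong ns rk≡i))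
    ... | tri> _ _ i<rk = inj₂ (inj₂ (ns-mono-≤ (s≤s z≤n) i<rk (npFlat-rk≤ {F} np)))

-- The degree map

module DegreeMap {n r rk} {D : List (Subset (suc n)) → ℚ} (degree : IsDegreeMap n r rk D) where

  open IsDegreeMap degree

  generators : List (Subset (suc n))
  generators = npFlats (suc n) rk

  generators-npFlat : All (IsNPFlat rk) generators
  generators-npFlat = all-filter (λ F → (isNPᵇ F ∧ isFlatᵇ rk F) ≟ᵇ true) (allSubsets (suc n))

  x-gamma-card≡0 : ∀ {F} → IsNPFlat rk F → ∀ R → suc (suc (length R)) ≡ r →
    evalProd generators (D ∘ (F ∷_)) (gamma n ∣ F ∣ ∷ R) ≡ 0ℚ
  x-gamma-card≡0 {F} PF R len = begin
    evalProd generators (D ∘ (F ∷_)) (gamma n ∣ F ∣ ∷ R)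
      ≡⟨ sumℚ-map-cong-All generators-npFlat (λ PG → cong (gamma n ∣ F ∣ _ *_)
           (evalProd-cong generators-npFlat R (λ ms Pms lenms →
             symmetric _ _ (PF ∷ PG ∷ Pms) (len′ ms lenms) (↭.swap F _ ↭.↭-refl)))) ⟩
    sumℚ (map (λ G → gamma n ∣ F ∣ G * W G) generators)
      ≡⟨ gamma-card-weighted-sum≡0 generators-npFlat F W _ vanish-incomparable incidence ⟩
    0ℚ ∎
    where
    W : Subset (suc n) → ℚ
    W G = evalProd generators (λ ms → D (G ∷ F ∷ ms)) R
    len′ : ∀ ms → length ms ≡ length R → suc (suc (length ms)) ≡ r
    len′ ms lenms = trans (cong (λ k → suc (suc k)) lenms) len
    vanish-incomparable : ∀ {G} → IsNPFlat rk G → ¬ F ⊆ G → ¬ G ⊆ F → W G ≡ 0ℚ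
    vanish-incomparable {G} PG F⊈G G⊈F = evalProd-zero generators-npFlat R (λ ms Pms lenms →
      incomparable (G ∷ F ∷ ms) F G (PG ∷ PF ∷ Pms) (len′ ms lenms) (there (here refl)) (here refl)
        F⊈G G⊈F)
    containing : Fin (suc n) → List (Subset (suc n))
    containing j = filter (λ G → memᵇ j G ≟ᵇ true) generators
    incidence-as-degree : ∀ j → sumℚ (map (λ G → indicator j G * W G) generators)
      ≡ evalProd generators (λ ms → sumℚ (map (λ G → D (G ∷ F ∷ ms)) (containing j))) R
    incidence-as-degree j = begin
      sumℚ (map (λ G → indicator j G * W G) generators)
        ≡⟨ sumℚ-map-cong generators (λ G → indicator-* j G (W G)) ⟩
      sumℚ (map (λ G → if memᵇ j G then W G else 0ℚ) generators)
        ≡⟨ sym (sumℚ-map-filter (memᵇ j) W generators) ⟩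
      sumℚ (map W (containing j))
        ≡⟨ sym (evalProd-sumℚ generators-npFlat R (containing j) (λ G ms → D (G ∷ F ∷ ms))) ⟩
      evalProd generators (λ ms → sumℚ (map (λ G → D (G ∷ F ∷ ms)) (containing j))) R ∎
    incidence : ∀ j → sumℚ (map (λ G → indicator j G * W G) generators)
                     ≡ sumℚ (map (λ G → indicator zero G * W G) generators)
    incidence j = trans (incidence-as-degree j) (trans
      (evalProd-cong generators-npFlat R (λ ms Pms lenms →
        linear (F ∷ ms) j zero (PF ∷ Pms) (len′ ms lenms)))
      (sym (incidence-as-degree zero)))

  mixedEulerian-↭ : ∀ c {ls} → gammaFactors n c ↭ ls → length ls ≡ r →
    mixedEulerian n rk D c ≡ evalProd generators D ls
  mixedEulerian-↭ c p len = evalProd-↭ generators-npFlat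
    (λ ms ms′ Pms lenms → symmetric ms ms′ Pms (trans lenms (trans (↭-length p) len))) p

  three-term : ∀ {A B C} → A ≤ B → B ≤ C → C ≤ suc n →
    (∀ {F} → IsNPFlat rk F → ∣ F ∣ ≤ A ⊎ ∣ F ∣ ≡ B ⊎ C ≤ ∣ F ∣) →
    ∀ R → suc (suc (length R)) ≡ r →
    (ℕtoℚ C - ℕtoℚ A) * evalProd generators D (gamma n B ∷ gamma n B ∷ R)
      ≡ (ℕtoℚ B - ℕtoℚ A) * evalProd generators D (gamma n C ∷ gamma n B ∷ R)
        + (ℕtoℚ C - ℕtoℚ B) * evalProd generators D (gamma n A ∷ gamma n B ∷ R)
  three-term {A} {B} {C} A≤B B≤C C≤ sizes R len =
    sumℚ-map-three-term generators-npFlat (ℕtoℚ C - ℕtoℚ A) (ℕtoℚ B - ℕtoℚ A) (ℕtoℚ C - ℕtoℚ B)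
      (gamma n B) (gamma n C) (gamma n A) kink X
      (λ {F} _ → gamma-three-term n F A≤B B≤C C≤) negligible
    where
    kink X : Subset (suc n) → ℚ
    kink F = ⊓-kink {A} {B} {C} ∣ F ∣
    X F = evalProd generators (D ∘ (F ∷_)) (gamma n B ∷ R)
    negligible : ∀ {F} → IsNPFlat rk F → kink F * X F ≡ 0ℚ
    negligible {F} PF with sizes {F} PF
    ... | inj₁ ∣F∣≤A        = trans (cong (_* X F) (⊓-kink-≤ A≤B B≤C ∣F∣≤A)) (*-zeroˡ (X F))
    ... | inj₂ (inj₂ C≤∣F∣) = trans (cong (_* X F) (⊓-kink-≥ A≤B B≤C C≤∣F∣)) (*-zeroˡ (X F))
    ... | inj₂ (inj₁ ∣F∣≡B) = trans (cong (kink F *_) X≡0) (*-zeroʳ (kink F))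
      where
      X≡0 : X F ≡ 0ℚ
      X≡0 = subst (λ k → evalProd generators (D ∘ (F ∷_)) (gamma n k ∷ R) ≡ 0ℚ) ∣F∣≡B
                  (x-gamma-card≡0 {F} PF R len)

corollary7p5 : (n r : ℕ) (rk : Subset (suc n) → ℕ) (ns : ℕ → ℕ) →
    IsSPMD n r rk ns →
    (D : List (Subset (suc n)) → ℚ) → IsDegreeMap n r rk D →
    (c : ℕ → ℕ) → c 0 ≡ 0 → (∀ k → suc n ≤ k → c k ≡ 0) → sumRange c n ≡ r →
    (i : ℕ) → 1 ≤ i → i ≤ r → 2 ≤ c (ns i) →
    (ℕtoℚ (ns (suc i)) - ℕtoℚ (ns (i ∸ 1))) * mixedEulerian n rk D c
      ≡ (ℕtoℚ (ns i) - ℕtoℚ (ns (i ∸ 1)))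
          * mixedEulerian n rk D (shift c (ns i) (ns (suc i)))
        + (ℕtoℚ (ns (suc i)) - ℕtoℚ (ns i))
          * mixedEulerian n rk D (shift c (ns i) (ns (i ∸ 1)))
corollary7p5 n r rk ns spmd D degree c c₀≡0 c-vanishes Σc≡r i 1≤i i≤r 2≤cB = begin
  (ℕtoℚ C - ℕtoℚ A) * mixedEulerian n rk D c
    ≡⟨ cong ((ℕtoℚ C - ℕtoℚ A) *_) (mixedEulerian-↭ c (gammaFactors-↭-twice n c 2≤cB B≤) len) ⟩
  (ℕtoℚ C - ℕtoℚ A) * evalProd generators D (gamma n B ∷ gamma n B ∷ R)
    ≡⟨ three-term (ℕ.<⇒≤ A<B) (ℕ.<⇒≤ B<C) C≤ (λ {F} → npFlat-size-trichotomy {F = F} 1≤i i≤r) R len ⟩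
  (ℕtoℚ B - ℕtoℚ A) * evalProd generators D (gamma n C ∷ gamma n B ∷ R)
    + (ℕtoℚ C - ℕtoℚ B) * evalProd generators D (gamma n A ∷ gamma n B ∷ R)
    ≡⟨ sym (cong₂ (λ u v → (ℕtoℚ B - ℕtoℚ A) * u + (ℕtoℚ C - ℕtoℚ B) * v)
         (mixedEulerian-↭ (shift c B C) (gammaFactors-↭-shift n c 2≤cB B≤ C≤) len)
         (mixedEulerian-↭ (shift c B A) (gammaFactors-↭-shift n c 2≤cB B≤ A≤) len)) ⟩
  (ℕtoℚ B - ℕtoℚ A) * mixedEulerian n rk D (shift c B C)
    + (ℕtoℚ C - ℕtoℚ B) * mixedEulerian n rk D (shift c B A) ∎
  where
  open SPMD spmd
  open DegreeMap degree
  A B C : ℕ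
  A = ns (i ∸ 1)
  B = ns i
  C = ns (suc i)
  R : List (Subset (suc n) → ℚ)
  R = gammaFactors n (lower (lower c B) B)
  B≤n : B ≤ n
  B≤n = support≤ c-vanishes (ℕ.≤-trans (s≤s z≤n) 2≤cB)
  B≤ : B ≤ suc n
  B≤ = ℕ.m≤n⇒m≤1+n B≤n
  A<B : A < B
  A<B = ns-pred<ns 1≤i i≤r
  B<C : B < C
  B<C = ns<ns-suc 1≤i i≤r B≤n
  A≤ : A ≤ suc n
  A≤ = ℕ.≤-trans (ℕ.<⇒≤ A<B) B≤
  C≤ : C ≤ suc n
  C≤ = ns-suc≤suc-n i≤r
  len : suc (suc (length R)) ≡ r
  len = trans (sym (↭-length (gammaFactors-↭-twice n c 2≤cB B≤)))
              (length-gammaFactors≡ c₀≡0 c-vanishes Σc≡r)
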